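{- Let $T$ be an $spo(2m,n)$-tableau and let $x,x'\in B_0$ with $x'>x$. If $spo$-insertion of $x'$ into $T$ causes a cancellation, then $spo$-insertion of $x$ into $T\leftarrow x'$ also causes a cancellation. Furthermore, the jeu de taquin path of the empty box created by inserting $x'$ into $T$ ends in a lower row than the jeu de taquin path of the empty box created by inserting $x$ into $T\leftarrow x'$.
   Context: Fix positive integers $m,n$. Let $B_0=\{1,\overline{1},\dots,m,\overline{m}\}$ and $B_1=\{1^\circ,\dots,n^\circ\}$, totally ordered by $1<\overline{1}<2<\overline{2}<\cdots<m<\overline{m}<1^\circ<\cdots<n^\circ$. Young diagrams are drawn with row $1$ on top (so "lower" means larger row index). An $spo(2m,n)$-tableau of shape $\lambda$ is a filling of the Young diagram of $\lambda$ with entries of $B_0\cup B_1$ such that the boxes with entries in $B_0$ form a Young diagram of a shape $\mu\subseteq\lambda$ on which entries weakly increase along rows, strictly increase down columns, and every entry in row $i$ is $\geq i$ (no $j$ or $\overline{j}$ with $j<i$ in row $i$); and the entries of $B_1$ in $\lambda/\mu$ strictly increase along rows and weakly increase down columns. Forward slide: for a filling with one empty box, with $x$ the entry immediately to its right and $y$ the entry immediately below; if only one exists it moves in; otherwise $x$ moves left if $x<y$ or $x=y\in B_1$, and $y$ moves up if $y<x$ or $x=y\in B_0$. Slides are repeated until the empty box is at an outer corner, where that box is deleted; the sequence of positions of the empty box is its jeu de taquin path, which ends at that outer corner. $spo$-insertion $T\leftarrow x$: insert $z=x$ into row 1; to insert $z$ into row $r$: if $z\in B_0$ and $z\geq$ all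 entries of row $r$, or $z\in B_1$ and $z>$ all entries of row $r$ (including an empty row below the tableau), append $z$ at the end of row $r$ and stop; otherwise let $z'$ be the leftmost entry of row $r$ with $z'\geq z$ (if $z\in B_1$) or with $z'>z$ (if $z\in B_0$), replace $z'$ by $z$ and insert $z'$ into row $r+1$. The insertion causes a cancellation if at some stage an $i\in\{1,\dots,m\}$ inserted into row $i$ would bump an $\overline{i}$ out of row $i$; in that case, at the first such stage the $\overline{i}$ is removed instead (and $i$ not placed), creating an empty box, and forward slides move this empty box to an outer corner, where it is deleted. -}

module Defs where

open import Data.Nat using (ℕ; zero; suc; _+_; _*_; _≤_; _<_; _≤ᵇ_; _<ᵇ_)
open import Data.Fin using (Fin; toℕ)
open import Data.List using (List; []; _∷_; _++_; [_]; length)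
open import Data.Product using (_×_; _,_)
open import Data.Bool using (Bool; true; false; if_then_else_; _∧_)
open import Data.Unit using (⊤)
open import Data.Empty using (⊥)
open import Data.Maybe using (Maybe; just; nothing)
open import Relation.Binary.PropositionalEquality using (_≡_)

-- The alphabet B₀ ∪ B₁.
--   ub i  =  i+1        (unbarred, i : Fin m is 0-based)
--   br i  =  \bar{i+1}  (barred)
--   ci j  =  (j+1)°     (element of B₁)

data Letter (m n : ℕ) : Set where
  ub : Fin m → Letter m n
  br : Fin m → Letter m n
  ci : Fin n → Letter m n

module _ {m n : ℕ} where

  -- total order 1 < 1̄ < 2 < 2̄ < ... < m < m̄ < 1° < ... < n°, via ranks
  rank : Letter m n → ℕ
  rank (ub i) = 2 * toℕ i
  rank (br i) = suc (2 * toℕ i)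
  rank (ci j) = 2 * m + toℕ j

  _<ᴸ_ : Letter m n → Letter m n → Set
  a <ᴸ b = rank a < rank b

  _≤ᴸ_ : Letter m n → Letter m n → Set
  a ≤ᴸ b = rank a ≤ rank b

  IsB0 : Letter m n → Set
  IsB0 (ub _) = ⊤
  IsB0 (br _) = ⊤
  IsB0 (ci _) = ⊥

  isB1 : Letter m n → Bool
  isB1 (ci _) = true
  isB1 _      = false

  -- spo(2m,n)-tableaux.  A filling is a list of rows, row 1 first.

  RowRel : Letter m n → Letter m n → Set
  RowRel (ci i) (ci j) = ci i <ᴸ ci j
  RowRel (ci _) _      = ⊥                   -- B₀ boxes form a left-justified part
  RowRel _      (ci _) = ⊤
  RowRel a      b      = a ≤ᴸ b

  ColRel : Letter m n → Letter m n → Set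
  ColRel (ci i) (ci j) = ci i ≤ᴸ ci j
  ColRel (ci _) _      = ⊥                   -- μ is a Young diagram
  ColRel _      (ci _) = ⊤
  ColRel a      b      = a <ᴸ b

  RowOK : List (Letter m n) → Set
  RowOK (a ∷ b ∷ xs) = RowRel a b × RowOK (b ∷ xs)
  RowOK _            = ⊤

  ColOK : List (Letter m n) → List (Letter m n) → Set
  ColOK _        []       = ⊤
  ColOK []       (_ ∷ _)  = ⊥
  ColOK (a ∷ as) (b ∷ bs) = ColRel a b × ColOK as bs

  -- every B₀ entry in row r (1-based) is ≥ r, i.e. no j, \bar j with j < r
  RowBound : ℕ → Letter m n → Set
  RowBound r (ub i) = r ≤ suc (toℕ i)
  RowBound r (br i) = r ≤ suc (toℕ i)
  RowBound r (ci _) = ⊤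

  AllBound : ℕ → List (Letter m n) → Set
  AllBound r []       = ⊤
  AllBound r (x ∷ xs) = RowBound r x × AllBound r xs

  NonEmpty : List (Letter m n) → Set
  NonEmpty []      = ⊥
  NonEmpty (_ ∷ _) = ⊤

  TabFrom : ℕ → List (List (Letter m n)) → Set
  TabFrom r []                  = ⊤
  TabFrom r (row ∷ [])          = NonEmpty row × RowOK row × AllBound r row
  TabFrom r (row ∷ row' ∷ rows) =
    NonEmpty row × RowOK row × AllBound r row × ColOK row row' × TabFrom (suc r) (row' ∷ rows)

  IsSpoTableau : List (List (Letter m n)) → Set
  IsSpoTableau = TabFrom 1

  -- The empty box sits in the current row between
  -- `pre` and `suf` (so its column is length pre); `below` are the rows
  -- under it.  Returns the new rows (from the current row downwards)
  -- together with the number of rows the empty box moved down.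

  splitAtCol : ℕ → List (Letter m n) → Maybe (List (Letter m n) × Letter m n × List (Letter m n))
  splitAtCol _       []       = nothing
  splitAtCol zero    (y ∷ ys) = just ([] , y , ys)
  splitAtCol (suc c) (y ∷ ys) with splitAtCol c ys
  ... | nothing            = nothing
  ... | just (p , z , s)   = just (y ∷ p , z , s)

  -- x (right neighbour) moves left iff x < y or x = y ∈ B₁
  moveLeft : Letter m n → Letter m n → Bool
  moveLeft x y = (rank x <ᵇ rank y) ∨' (isB1 x ∧ (rank x ≡ᵇ rank y))
    where
    _∨'_ : Bool → Bool → Bool
    true  ∨' _ = true
    false ∨' b = b
    _≡ᵇ_ : ℕ → ℕ → Bool
    a ≡ᵇ b = (a ≤ᵇ b) ∧ (b ≤ᵇ a)

  finish : List (Letter m n) → List (List (Letter m n)) → List (List (Letter m n))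
  finish []          below = below
  finish pre@(_ ∷ _) below = pre ∷ below

  addRow : List (Letter m n) → List (List (Letter m n)) × ℕ → List (List (Letter m n)) × ℕ
  addRow row (rs , k) = (row ∷ rs) , suc k

  choose : {A : Set} → Bool → A → A → A
  choose true  a _ = a
  choose false _ b = b

  belowEntry : List (Letter m n) → List (List (Letter m n))
             → Maybe (List (Letter m n) × Letter m n × List (Letter m n))
  belowEntry pre []           = nothing
  belowEntry pre (next ∷ _)   = splitAtCol (length pre) next

  Split : Set
  Split = Maybe (List (Letter m n) × Letter m n × List (Letter m n))

  mutual
    jdt : List (List (Letter m n)) → List (Letter m n) → List (Letter m n)
        → List (List (Letter m n)) × ℕ
    jdt below pre suf = jdtStep below pre suf (belowEntry pre below)

    -- last argument: the row below split at the empty box's column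
    jdtStep : List (List (Letter m n)) → List (Letter m n) → List (Letter m n)
            → Split → List (List (Letter m n)) × ℕ
    jdtStep below pre [] nothing = finish pre below , 0
    jdtStep below pre (x ∷ xs) nothing = jdt below (pre ++ [ x ]) xs
    jdtStep [] pre [] (just _) = finish pre [] , 0   -- impossible case
    jdtStep (_ ∷ rest) pre [] (just (p , y , s)) =
      addRow (pre ++ [ y ]) (jdt rest p s)
    jdtStep [] pre (x ∷ xs) (just _) = jdt [] (pre ++ [ x ]) xs  -- impossible case
    jdtStep (next ∷ rest) pre (x ∷ xs) (just (p , y , s)) =
      choose (moveLeft x y) (jdt (next ∷ rest) (pre ++ [ x ]) xs)
                            (addRow (pre ++ y ∷ x ∷ xs) (jdt rest p s))

  bumps : Letter m n → Letter m n → Bool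
  bumps z z' = if isB1 z then rank z ≤ᵇ rank z' else rank z <ᵇ rank z'

  data RowRes : Set where
    appendR : RowRes
    bumpR   : List (Letter m n) → Letter m n → List (Letter m n) → RowRes

  -- leftmost bumped entry: row = pre ++ z' ∷ suf
  rowIns : Letter m n → List (Letter m n) → RowRes
  rowIns z [] = appendR
  rowIns z (y ∷ ys) with bumps z y
  ... | true  = bumpR [] y ys
  ... | false with rowIns z ys
  ...   | appendR       = appendR
  ...   | bumpR p w s   = bumpR (y ∷ p) w s

  data InsResult : Set where
    normal : List (List (Letter m n)) → InsResult
    -- cancellation: the resulting tableau and the row (1-based) in which
    -- the jeu de taquin path of the created empty box ends
    cancel : List (List (Letter m n)) → ℕ → InsResult

  consRow : List (Letter m n) → InsResult → InsResult
  consRow row (normal t)   = normal (row ∷ t)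
  consRow row (cancel t e) = cancel (row ∷ t) e

  -- is this stage a cancellation: i inserted into row i bumping \bar i ?
  isCancel : ℕ → Letter m n → Letter m n → Bool
  isCancel r (ub i) (br j) = (toℕ i ≤ᵇ toℕ j) ∧ (toℕ j ≤ᵇ toℕ i) ∧ (r ≤ᵇ suc (toℕ i)) ∧ (suc (toℕ i) ≤ᵇ r)
  isCancel r _ _ = false

  -- insert z into row r (1-based) of the rows given (rows r, r+1, ...)
  insFrom : ℕ → Letter m n → List (List (Letter m n)) → InsResult
  insFrom r z [] = normal ([ z ] ∷ [])
  insFrom r z (row ∷ rows) with rowIns z row
  ... | appendR = normal ((row ++ [ z ]) ∷ rows)
  ... | bumpR pre z' suf with isCancel r z z'
  ...   | false = consRow (pre ++ z ∷ suf) (insFrom (suc r) z' rows)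
  ...   | true with jdt rows pre suf
  ...     | rs , k = cancel rs (r + k)

  spoInsert : List (List (Letter m n)) → Letter m n → InsResult
  spoInsert T x = insFrom 1 x T

  result : InsResult → List (List (Letter m n))
  result (normal t)   = t
  result (cancel t _) = t

module Submission where

-- Write z'ᵣ and zᵣ for the letters inserted into row r when x' is inserted into T and x
-- into T₁ = T ← x'.  Row by row, zᵣ < z'ᵣ, so zᵣ bumps an entry weakly left of the
-- position where z'ᵣ now sits, whence z_{r+1} ≤ z'ᵣ < z'_{r+1}; and a bump that does not
-- cancel keeps the letter ≥ the row number.  If x' cancels in row i then z'ᵢ = i, and zᵢ
-- would be both < i and ≥ i; so x cancels in some row above i.
--
-- For the paths, let the slide started by x' run from row i.  In row i - 1 of T₁ the
-- entries up to the column where z'ᵢ left are < i, hence smaller than every entry of row i,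
-- so an empty box there moves right at least until it is above the start of the first path;
-- following that path down, whenever the new box leaves a row it does so weakly right of
-- where the first path left it, and from there every slide is strictly shorter.  So every
-- empty box created in a row above i ends above the end of the first path.

open import Defs
open import Data.Nat using (ℕ; zero; suc; _+_; _*_; _≤_; _<_; _≤ᵇ_; _<ᵇ_; z≤n; s≤s)
open import Data.Nat.Properties
open import Data.Fin using (Fin; toℕ)
open import Data.Fin.Properties using (toℕ<n; toℕ-injective)
open import Data.Bool using (Bool; true; false; T)
open import Data.Bool.Properties using (T-≡)
open import Data.List using (List; []; _∷_; _++_; [_]; length; drop)
open import Data.List.Properties using (length-++)
open import Data.List.Relation.Unary.All using (All; []; _∷_)
open import Data.Maybe using (Maybe; just; nothing)
open import Data.Product using (Σ; ∃₂; _×_; _,_; proj₁; proj₂)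
open import Data.Sum using (inj₁; inj₂)
open import Data.Unit using (⊤; tt)
open import Data.Empty using (⊥; ⊥-elim)
open import Function using (Equivalence)
open import Relation.Binary using (tri<; tri≈; tri>)
open import Relation.Binary.PropositionalEquality hiding ([_])
open import Relation.Nullary using (¬_; yes; no)

T⇒true : ∀ {b} → T b → b ≡ true
T⇒true = Equivalence.to T-≡

true⇒T : ∀ {b} → b ≡ true → T b
true⇒T = Equivalence.from T-≡

≤ᵇ-refl : ∀ k → (k ≤ᵇ k) ≡ true
≤ᵇ-refl k = T⇒true (≤⇒≤ᵇ (≤-refl {k}))

<ᵇ-irrefl : ∀ k → (k <ᵇ k) ≡ false
<ᵇ-irrefl zero    = refl
<ᵇ-irrefl (suc k) = <ᵇ-irrefl k

double-≤-odd : ∀ a b → 2 * a ≤ suc (2 * b) → a ≤ b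
double-≤-odd a b le = <⇒≤pred (*-cancelˡ-< 2 a (suc b) (≤-trans (s≤s le) (≤-reflexive (sym (*-suc 2 b)))))

module _ {A : Set} where

  infixl 5 _‼_
  _‼_ : List A → ℕ → Maybe A
  []       ‼ _     = nothing
  (x ∷ xs) ‼ zero  = just x
  (x ∷ xs) ‼ suc b = xs ‼ b

  ‼-++ˡ : (xs : List A) {ys : List A} {b : ℕ} → b < length xs → (xs ++ ys) ‼ b ≡ xs ‼ b
  ‼-++ˡ (x ∷ xs) {b = zero}  _         = refl
  ‼-++ˡ (x ∷ xs) {b = suc b} (s≤s b<) = ‼-++ˡ xs b<

  ‼-++ʳ : (xs : List A) {ys : List A} (b : ℕ) → (xs ++ ys) ‼ (length xs + b) ≡ ys ‼ b
  ‼-++ʳ []       b = refl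
  ‼-++ʳ (x ∷ xs) b = ‼-++ʳ xs b

  ‼-here : (p : List A) (y : A) (s : List A) → (p ++ y ∷ s) ‼ length p ≡ just y
  ‼-here p y s = trans (cong ((p ++ y ∷ s) ‼_) (sym (+-identityʳ (length p)))) (‼-++ʳ p 0)

  ‼-drop : (k : ℕ) (xs : List A) (b : ℕ) → drop k xs ‼ b ≡ xs ‼ (k + b)
  ‼-drop zero    xs       b = refl
  ‼-drop (suc k) []       b = refl
  ‼-drop (suc k) (x ∷ xs) b = ‼-drop k xs b

  ‼-drop-0 : (k : ℕ) (xs : List A) → drop k xs ‼ 0 ≡ xs ‼ k
  ‼-drop-0 zero    xs       = refl
  ‼-drop-0 (suc k) []       = refl
  ‼-drop-0 (suc k) (x ∷ xs) = ‼-drop-0 k xs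

  drop-mid : (p : List A) (y : A) (s : List A) → drop (suc (length p)) (p ++ y ∷ s) ≡ s
  drop-mid []      y s = refl
  drop-mid (_ ∷ p) y s = drop-mid p y s

  drop-mid-at : (p : List A) (y : A) (s : List A) {c : ℕ} → length p ≡ c → drop (suc c) (p ++ y ∷ s) ≡ s
  drop-mid-at p y s refl = drop-mid p y s

  ‼-at : (p : List A) (y : A) (s : List A) {c : ℕ} → length p ≡ c → (p ++ y ∷ s) ‼ c ≡ just y
  ‼-at p y s refl = ‼-here p y s

  ‼-exists : (xs : List A) {b : ℕ} → b < length xs → Σ A λ x → xs ‼ b ≡ just x
  ‼-exists (x ∷ xs) {zero}  _         = x , refl
  ‼-exists (x ∷ xs) {suc b} (s≤s b<) = ‼-exists xs b<

  ‼-All : {P : A → Set} {xs : List A} → All P xs → ∀ {b y} → xs ‼ b ≡ just y → P y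
  ‼-All (px ∷ _)  {zero}  refl = px
  ‼-All (_  ∷ ps) {suc b} e    = ‼-All ps e

  ‼-replace : (p : List A) (a a' : A) (s : List A) {b : ℕ} → b ≢ length p → (p ++ a ∷ s) ‼ b ≡ (p ++ a' ∷ s) ‼ b
  ‼-replace []      a a' s {zero}  b≢ = ⊥-elim (b≢ refl)
  ‼-replace []      a a' s {suc b} b≢ = refl
  ‼-replace (_ ∷ p) a a' s {zero}  b≢ = refl
  ‼-replace (_ ∷ p) a a' s {suc b} b≢ = ‼-replace p a a' s (λ e → b≢ (cong suc e))

  length-∷ʳ : (p : List A) (x : A) → length (p ++ [ x ]) ≡ suc (length p)
  length-∷ʳ p x = trans (length-++ p) (+-comm (length p) 1)

  length-≤-∷ʳ : (p : List A) (x : A) → length p ≤ length (p ++ [ x ])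
  length-≤-∷ʳ p x = ≤-trans (n≤1+n _) (≤-reflexive (sym (length-∷ʳ p x)))

  drop-suc : (k : ℕ) (xs : List A) → drop (suc k) xs ≡ drop 1 (drop k xs)
  drop-suc zero    xs       = refl
  drop-suc (suc k) []       = refl
  drop-suc (suc k) (x ∷ xs) = drop-suc k xs

  drop-past-∷ʳ : (p : List A) (x : A) (xs : List A) →
                 drop (suc (length (p ++ [ x ]))) xs ≡ drop 1 (drop (suc (length p)) xs)
  drop-past-∷ʳ p x xs rewrite length-∷ʳ p x = drop-suc (suc (length p)) xs

module _ {m n : ℕ} where

  private
    L    = Letter m n
    Row  = List L
    Rows = List Row

  rank-B0 : (a : L) → IsB0 a → rank a < 2 * m
  rank-B0 (ub i) _ = *-monoʳ-< 2 (toℕ<n i)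
  rank-B0 (br i) _ = ≤-trans (≤-reflexive (sym (*-suc 2 (toℕ i)))) (*-monoʳ-≤ 2 (toℕ<n i))

  B0-by-rank : (a : L) → rank a < 2 * m → IsB0 a
  B0-by-rank (ub i) _  = tt
  B0-by-rank (br i) _  = tt
  B0-by-rank (ci j) lt = <-irrefl refl (<-≤-trans lt (m≤m+n _ _))

  below-B0 : (a b : L) → IsB0 b → a <ᴸ b → IsB0 a
  below-B0 a b b∈B0 a<b = B0-by-rank a (<-trans a<b (rank-B0 b b∈B0))

  B0<B1 : (a : L) (j : Fin n) → IsB0 a → a <ᴸ ci j
  B0<B1 a j a∈B0 = <-≤-trans (rank-B0 a a∈B0) (m≤m+n _ _)

  moveLeft-< : (x y : L) → x <ᴸ y → moveLeft x y ≡ true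
  moveLeft-< x y x<y rewrite T⇒true (<⇒<ᵇ x<y) = refl

  moveLeft-B1 : (i j : Fin n) → ci {m} i ≤ᴸ ci j → moveLeft {m} (ci i) (ci j) ≡ true
  moveLeft-B1 i j le with m≤n⇒m<n∨m≡n le
  ... | inj₁ lt = moveLeft-< (ci i) (ci j) lt
  ... | inj₂ eq rewrite sym eq | <ᵇ-irrefl (2 * m + toℕ i) | ≤ᵇ-refl (2 * m + toℕ i) = refl

  ColRel-B0⇒< : (a b : L) → IsB0 a → ColRel a b → a <ᴸ b
  ColRel-B0⇒< (ub i) (ub j) _ c = c
  ColRel-B0⇒< (ub i) (br j) _ c = c
  ColRel-B0⇒< (ub i) (ci j) _ c = B0<B1 (ub i) j tt
  ColRel-B0⇒< (br i) (ub j) _ c = c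
  ColRel-B0⇒< (br i) (br j) _ c = c
  ColRel-B0⇒< (br i) (ci j) _ c = B0<B1 (br i) j tt

  ColRel⇒≤ : (a b : L) → ColRel a b → a ≤ᴸ b
  ColRel⇒≤ (ci i) (ci j) c = c
  ColRel⇒≤ (ub i) b      c = <⇒≤ (ColRel-B0⇒< (ub i) b tt c)
  ColRel⇒≤ (br i) b      c = <⇒≤ (ColRel-B0⇒< (br i) b tt c)

  ColRel⇒moveLeft : (a b : L) → ColRel a b → moveLeft a b ≡ true
  ColRel⇒moveLeft (ci i) (ci j) c = moveLeft-B1 i j c
  ColRel⇒moveLeft (ub i) b      c = moveLeft-< (ub i) b (ColRel-B0⇒< (ub i) b tt c)
  ColRel⇒moveLeft (br i) b      c = moveLeft-< (br i) b (ColRel-B0⇒< (br i) b tt c)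

  bumps-B0⇒< : (z w : L) → IsB0 z → bumps z w ≡ true → z <ᴸ w
  bumps-B0⇒< (ub i) w _ e = <ᵇ⇒< _ _ (true⇒T e)
  bumps-B0⇒< (br i) w _ e = <ᵇ⇒< _ _ (true⇒T e)

  unbumped-B0⇒≤ : (z w : L) → IsB0 z → bumps z w ≡ false → w ≤ᴸ z
  unbumped-B0⇒≤ (ub i) w _ e = ≮⇒≥ (λ lt → subst T e (<⇒<ᵇ lt))
  unbumped-B0⇒≤ (br i) w _ e = ≮⇒≥ (λ lt → subst T e (<⇒<ᵇ lt))

  <⇒bumps-B0 : (z w : L) → IsB0 z → z <ᴸ w → bumps z w ≡ true
  <⇒bumps-B0 (ub i) w _ lt = T⇒true (<⇒<ᵇ lt)
  <⇒bumps-B0 (br i) w _ lt = T⇒true (<⇒<ᵇ lt)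

  bumper-B0 : (z w : L) → bumps z w ≡ true → IsB0 w → IsB0 z
  bumper-B0 (ub i) w _ _    = tt
  bumper-B0 (br i) w _ _    = tt
  bumper-B0 (ci j) w e w∈B0 =
    <-irrefl refl (<-≤-trans (rank-B0 w w∈B0) (≤-trans (m≤m+n (2 * m) (toℕ j)) (≤ᵇ⇒≤ _ _ (true⇒T e))))

  isCancel-inv : (r : ℕ) (z w : L) → isCancel r z w ≡ true → Σ (Fin m) λ i → z ≡ ub i × r ≡ suc (toℕ i)
  isCancel-inv r (ub i) (br j) e
    with toℕ i ≤ᵇ toℕ j | toℕ j ≤ᵇ toℕ i | r ≤ᵇ suc (toℕ i) in r≤ | suc (toℕ i) ≤ᵇ r in r≥
  isCancel-inv r (ub i) (br j) refl | true | true | true | true =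
    i , refl , ≤-antisym (≤ᵇ⇒≤ _ _ (true⇒T r≤)) (≤ᵇ⇒≤ _ _ (true⇒T r≥))

  isCancel-diag : (i : Fin m) → isCancel {m} {n} (suc (toℕ i)) (ub i) (br i) ≡ true
  isCancel-diag i rewrite ≤ᵇ-refl (toℕ i) | ≤ᵇ-refl (suc (toℕ i)) = refl

  rowBound-bumped : (k : ℕ) (z w : L) → IsB0 z → 2 * k ≤ rank z → z <ᴸ w →
                    isCancel (suc k) z w ≡ false → 2 * suc k ≤ rank w
  rowBound-bumped k (br i) w _ le z<w _ =
    ≤-trans (*-monoʳ-≤ 2 (s≤s (double-≤-odd k (toℕ i) le))) (≤-trans (≤-reflexive (*-suc 2 (toℕ i))) z<w)
  rowBound-bumped k (ub i) w _ le z<w nc with m≤n⇒m<n∨m≡n {k} {toℕ i} (*-cancelˡ-≤ 2 le)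
  ... | inj₁ k<i = ≤-trans (*-monoʳ-≤ 2 k<i) (<⇒≤ z<w)
  rowBound-bumped _ (ub i) (ub j) _ _ z<w nc | inj₂ refl = *-monoʳ-≤ 2 (*-cancelˡ-< 2 (toℕ i) (toℕ j) z<w)
  rowBound-bumped _ (ub i) (ci j) _ _ z<w nc | inj₂ refl = ≤-trans (*-monoʳ-≤ 2 (toℕ<n i)) (m≤m+n _ _)
  rowBound-bumped _ (ub i) (br j) _ _ z<w nc | inj₂ refl with m≤n⇒m<n∨m≡n (double-≤-odd _ _ (<⇒≤ z<w))
  ... | inj₁ i<j = ≤-trans (*-monoʳ-≤ 2 i<j) (n≤1+n _)
  ... | inj₂ i≡j with toℕ-injective {i = i} {j} i≡j
  ... | refl with trans (sym nc) (isCancel-diag i)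
  ... | ()

  -- Row insertion

  topRow : Rows → Row
  topRow []      = []
  topRow (R ∷ _) = R

  NotBumping : L → Row → Set
  NotBumping z = All (λ w → bumps z w ≡ false)

  data RowInsertion (z : L) (R : Row) : RowRes → Set where
    appended : NotBumping z R → RowInsertion z R appendR
    bumped   : ∀ {pre w suf} → R ≡ pre ++ w ∷ suf → bumps z w ≡ true → NotBumping z pre →
               RowInsertion z R (bumpR pre w suf)

  rowInsertion : (z : L) (R : Row) → RowInsertion z R (rowIns z R)
  rowInsertion z []       = appended []
  rowInsertion z (y ∷ ys) with bumps z y in zy
  ... | true  = bumped refl zy []
  ... | false with rowIns z ys | rowInsertion z ys
  ...   | appendR     | appended ¬b    = appended (zy ∷ ¬b)
  ...   | bumpR _ _ _ | bumped e zw ¬b = bumped (cong (y ∷_) e) zw (zy ∷ ¬b)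

  data InsertionStep (r : ℕ) (z : L) (R : Row) (rows : Rows) : InsResult → Set where
    appends : NotBumping z R → InsertionStep r z R rows (normal ((R ++ [ z ]) ∷ rows))
    cancels : ∀ pre w suf → R ≡ pre ++ w ∷ suf → NotBumping z pre → isCancel r z w ≡ true →
              InsertionStep r z R rows (cancel (proj₁ (jdt rows pre suf)) (r + proj₂ (jdt rows pre suf)))
    passes  : ∀ pre w suf → R ≡ pre ++ w ∷ suf → bumps z w ≡ true → NotBumping z pre → isCancel r z w ≡ false →
              InsertionStep r z R rows (consRow (pre ++ z ∷ suf) (insFrom (suc r) w rows))

  insertionStep : (r : ℕ) (z : L) (R : Row) (rows : Rows) → InsertionStep r z R rows (insFrom r z (R ∷ rows))
  insertionStep r z R rows with rowIns z R | rowInsertion z R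
  ... | appendR         | appended ¬b    = appends ¬b
  ... | bumpR pre w suf | bumped e zw ¬b with isCancel r z w in c
  ...   | true  = cancels pre w suf e ¬b c
  ...   | false = passes pre w suf e zw ¬b c

  consRow-inv : (row : Row) (X : InsResult) {T₁ : Rows} {r₁ : ℕ} → consRow row X ≡ cancel T₁ r₁ →
                Σ Rows λ T₁' → X ≡ cancel T₁' r₁ × T₁ ≡ row ∷ T₁'
  consRow-inv row (cancel T₁' _) refl = T₁' , refl , refl

  cancelling⇒B0 : (r : ℕ) (z : L) (rows : Rows) {T₁ : Rows} {r₁ : ℕ} → insFrom r z rows ≡ cancel T₁ r₁ → IsB0 z
  cancelling⇒B0 r (ub i) rows _ = tt
  cancelling⇒B0 r (br i) rows _ = tt
  cancelling⇒B0 r (ci j) (R ∷ rows) eq with insFrom r (ci j) (R ∷ rows) | insertionStep r (ci j) R rows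
  cancelling⇒B0 r (ci j) (R ∷ rows) () | _ | appends _
  cancelling⇒B0 r (ci j) (R ∷ rows) eq | _ | cancels _ _ _ _ _ ()
  cancelling⇒B0 r (ci j) (R ∷ rows) eq | _ | passes pre w suf _ jw _ _
    with consRow-inv (pre ++ ci j ∷ suf) (insFrom (suc r) w rows) eq
  ... | _ , eq' , _ = bumper-B0 (ci j) w jw (cancelling⇒B0 (suc r) w rows eq')

  tab-bound : {r : ℕ} {R : Row} {rows : Rows} → TabFrom r (R ∷ rows) → AllBound r R
  tab-bound {rows = []}    (_ , _ , ab)         = ab
  tab-bound {rows = _ ∷ _} (_ , _ , ab , _ , _) = ab

  tab-col : {r : ℕ} {R : Row} {rows : Rows} → TabFrom r (R ∷ rows) → ColOK R (topRow rows)
  tab-col {rows = []}    _                    = tt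
  tab-col {rows = _ ∷ _} (_ , _ , _ , co , _) = co

  tab-tail : {r : ℕ} {R : Row} {rows : Rows} → TabFrom r (R ∷ rows) → TabFrom (suc r) rows
  tab-tail {rows = []}    _                    = tt
  tab-tail {rows = _ ∷ _} (_ , _ , _ , _ , tf) = tf

  ColsOK : Rows → Set
  ColsOK []         = ⊤
  ColsOK (R ∷ rows) = ColOK R (topRow rows) × ColsOK rows

  tab⇒ColsOK : {r : ℕ} (rows : Rows) → TabFrom r rows → ColsOK rows
  tab⇒ColsOK []         _   = tt
  tab⇒ColsOK (R ∷ rows) tab = tab-col tab , tab⇒ColsOK rows (tab-tail tab)

  rowBound-‼ : (k : ℕ) → k ≤ m → (R : Row) → AllBound (suc k) R → ∀ {b w} → R ‼ b ≡ just w → 2 * k ≤ rank w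
  rowBound-‼ k k≤m (ub i ∷ R) (rb , _)  {zero}  refl = *-monoʳ-≤ 2 (≤-pred rb)
  rowBound-‼ k k≤m (br i ∷ R) (rb , _)  {zero}  refl = ≤-trans (*-monoʳ-≤ 2 (≤-pred rb)) (n≤1+n _)
  rowBound-‼ k k≤m (ci j ∷ R) _         {zero}  refl = ≤-trans (*-monoʳ-≤ 2 k≤m) (m≤m+n _ _)
  rowBound-‼ k k≤m (_ ∷ R)    (_ , ab)  {suc b} e    = rowBound-‼ k k≤m R ab e

  ColOK-‼ : (R S : Row) → ColOK R S → ∀ {b y} → S ‼ b ≡ just y → Σ L λ x → R ‼ b ≡ just x × ColRel x y
  ColOK-‼ (a ∷ R) (c ∷ S) (ac , _) {zero}  refl = a , refl , ac
  ColOK-‼ (a ∷ R) (c ∷ S) (_ , co) {suc b} e    = ColOK-‼ R S co e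

  MovesLeftOver : Row → Row → Set
  MovesLeftOver R S = ∀ b {y} → S ‼ b ≡ just y → Σ L λ u → R ‼ b ≡ just u × moveLeft u y ≡ true

  ColOK⇒MovesLeftOver : (R S : Row) → ColOK R S → MovesLeftOver R S
  ColOK⇒MovesLeftOver R S co b e with ColOK-‼ R S co e
  ... | x , ex , xy = x , ex , ColRel⇒moveLeft x _ xy

  movesLeftOver-drop : (k : ℕ) (R S : Row) → MovesLeftOver R S → MovesLeftOver (drop k R) (drop k S)
  movesLeftOver-drop k R S RS b e with RS (k + b) (trans (sym (‼-drop k S b)) e)
  ... | u , eu , uy = u , trans (‼-drop k R b) eu , uy

  -- Jeu de taquin paths

  split-just : (c : ℕ) (R : Row) {p : Row} {y : L} {s : Row} →
               splitAtCol c R ≡ just (p , y , s) → R ≡ p ++ y ∷ s × length p ≡ c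
  split-just zero    (y ∷ ys) refl = refl , refl
  split-just (suc c) (y ∷ ys) e with splitAtCol c ys in e'
  split-just (suc c) (y ∷ ys) refl | just (p , z , s) with split-just c ys e'
  ... | refl , refl = refl , refl

  split-nothing : (c : ℕ) (R : Row) → splitAtCol c R ≡ nothing → length R ≤ c
  split-nothing c       []       _ = z≤n
  split-nothing (suc c) (y ∷ ys) e with splitAtCol c ys in e'
  split-nothing (suc c) (y ∷ ys) refl | nothing = s≤s (split-nothing c ys e')

  split-none : (below : Rows) {pre : Row} → belowEntry pre below ≡ nothing → length (topRow below) ≤ length pre
  split-none []           _  = z≤n
  split-none (next ∷ _) {pre} es = split-nothing (length pre) next es

  jdt-nil : (pre suf : Row) → proj₂ (jdt [] pre suf) ≡ 0
  jdt-nil pre []       = refl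
  jdt-nil pre (x ∷ xs) = jdt-nil (pre ++ [ x ]) xs

  -- Removing an entry at a column ≥ E from the top row starts a slide descending fewer than k rows.
  Shallow : ℕ → ℕ → Rows → Set
  Shallow k E []         = ⊤
  Shallow k E (R ∷ rows) = ∀ pre y suf → R ≡ pre ++ y ∷ suf → E ≤ length pre → proj₂ (jdt rows pre suf) < k

  -- With U directly above S, an empty box in U at any column in [Lo, E) moves right.
  SlidesRight : Row → Row → ℕ → ℕ → Set
  SlidesRight U S Lo E = ∀ b → Lo ≤ b → b < E →
    Σ L λ u → Σ L λ y → U ‼ suc b ≡ just u × S ‼ b ≡ just y × moveLeft u y ≡ true

  slidesRight-from : {U S : Row} {Lo Lo' E : ℕ} → Lo ≤ Lo' → SlidesRight U S Lo E → SlidesRight U S Lo' E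
  slidesRight-from Lo≤ F b lo hi = F b (≤-trans Lo≤ lo) hi

  slidesRight-++ : {U S S' : Row} {Lo : ℕ} → SlidesRight U S Lo (length S) → SlidesRight U (S ++ S') Lo (length S)
  slidesRight-++ {S = S} F b lo hi with F b lo hi
  ... | u , y , eu , ey , uy = u , y , eu , trans (‼-++ˡ S hi) ey , uy

  slidesRight-∷ʳ : {U S : Row} {Lo : ℕ} {u x : L} → SlidesRight U S Lo (length S) →
                   U ‼ suc (length S) ≡ just u → moveLeft u x ≡ true →
                   SlidesRight U (S ++ [ x ]) Lo (length (S ++ [ x ]))
  slidesRight-∷ʳ {U} {S} {u = u} {x} F eu ux b lo hi
    with m≤n⇒m<n∨m≡n (≤-pred (subst (b <_) (length-∷ʳ S x) hi))
  ... | inj₁ b<S = slidesRight-++ {U} {S} {[ x ]} F b lo b<S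
  ... | inj₂ refl = u , x , eu , ‼-here S x [] , ux

  slide-blocked : (S U pre : Row) {suf : Row} {E : ℕ} {y : L} → suf ≡ drop (suc (length pre)) U →
                  SlidesRight U S (length pre) E → S ‼ length pre ≡ just y →
                  (∀ {x} → suf ‼ 0 ≡ just x → moveLeft x y ≡ false) → E ≤ length pre
  slide-blocked S U pre {E = E} eU F ey stuck = ≮⇒≥ moves
    where
    moves : ¬ (length pre < E)
    moves lt with F (length pre) ≤-refl lt
    ... | u , y' , eu , ey' , uy with trans (sym ey) ey'
    ... | refl with trans (sym (stuck (trans (cong (_‼ 0) eU) (trans (‼-drop-0 (suc (length pre)) U) eu)))) uy
    ... | ()

  suffix-∷ʳ : (U pre : Row) {x : L} {xs : Row} →
              x ∷ xs ≡ drop (suc (length pre)) U → xs ≡ drop (suc (length (pre ++ [ x ]))) U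
  suffix-∷ʳ U pre {x} e = trans (cong (drop 1) e) (sym (drop-past-∷ʳ pre x U))

  slide-past : (below : Rows) (pre suf U : Row) {E k : ℕ} → suf ≡ drop (suc (length pre)) U →
               SlidesRight U (topRow below) (length pre) E → Shallow k E below → proj₂ (jdt below pre suf) < suc k
  slide-past []            pre suf      U _  _ _ rewrite jdt-nil pre suf = s≤s z≤n
  slide-past (next ∷ rest) pre suf      U eU F G with splitAtCol (length pre) next in es
  slide-past (next ∷ rest) pre []       U eU F G | nothing = s≤s z≤n
  slide-past (next ∷ rest) pre (x ∷ xs) U eU F G | nothing =
    slide-past (next ∷ rest) (pre ++ [ x ]) xs U (suffix-∷ʳ U pre eU)
      (slidesRight-from {U} {next} (length-≤-∷ʳ pre x) F) G
  slide-past (next ∷ rest) pre suf      U eU F G | just (p , y , s) with split-just (length pre) next es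
  slide-past (_ ∷ rest)    pre []       U eU F G | just (p , y , s) | refl , lp =
    s≤s (G p y s refl (≤-trans (slide-blocked (p ++ y ∷ s) U pre eU F (‼-at p y s lp) λ ()) (≤-reflexive (sym lp))))
  slide-past (_ ∷ rest)    pre (x ∷ xs) U eU F G | just (p , y , s) | refl , lp with moveLeft x y in xy
  ... | true  = slide-past _ (pre ++ [ x ]) xs U (suffix-∷ʳ U pre eU)
                  (slidesRight-from {U} {p ++ y ∷ s} (length-≤-∷ʳ pre x) F) G
  ... | false =
    s≤s (G p y s refl (≤-trans (slide-blocked (p ++ y ∷ s) U pre eU F (‼-at p y s lp) λ { refl → xy })
                               (≤-reflexive (sym lp))))

  SlideBound : Row → ℕ → Rows × ℕ → Set
  SlideBound U Lo (rows , k) = Σ ℕ λ E → SlidesRight U (topRow rows) Lo E × Shallow k E rows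

  shallow-above : (U : Row) {Lo k : ℕ} (rows : Rows) → SlideBound U Lo (rows , k) → Shallow (suc k) Lo (U ∷ rows)
  shallow-above _ rows (E , F , G) p y s refl Lo≤p =
    slide-past rows p s (p ++ y ∷ s) (sym (drop-mid p y s)) (slidesRight-from {p ++ y ∷ s} {topRow rows} Lo≤p F) G

  shallow-narrow : {k E : ℕ} (rows : Rows) → length (topRow rows) ≤ E → Shallow k E rows
  shallow-narrow []         _       = tt
  shallow-narrow (_ ∷ rows) R≤E p y s refl E≤p =
    ⊥-elim (<-irrefl refl (<-≤-trans (m<m+n (length p) (s≤s z≤n))
                                      (≤-trans (≤-reflexive (sym (length-++ p))) (≤-trans R≤E E≤p))))

  stop-bound : (U pre : Row) (below : Rows) {Lo : ℕ} → length (topRow below) ≤ length pre →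
               SlidesRight U pre Lo (length pre) → SlideBound U Lo (finish pre below , 0)
  stop-bound U []          below below≤ F = 0 , (λ _ _ ()) , shallow-narrow below below≤
  stop-bound U pre@(_ ∷ _) below below≤ F = length pre , F , shallow-narrow (pre ∷ below) ≤-refl

  descend-bound : (U pre : Row) (y : L) (suf : Row) {Lo : ℕ} (r : Rows × ℕ) → SlidesRight U pre Lo (length pre) →
                  SlideBound (pre ++ y ∷ suf) (length pre) r → SlideBound U Lo (addRow (pre ++ y ∷ suf) r)
  descend-bound U pre y suf (rows , k) F B =
    length pre , slidesRight-++ {U} {pre} F , shallow-above (pre ++ y ∷ suf) rows B

  -- The empty box sits after pre in the current row, U is the row above it and topRow below the
  -- row under it; dropping suc (length pre) entries aligns the columns right of the box with suf.
  SlideInvariant : Row → ℕ → Rows → Row → Row → Set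
  SlideInvariant U Lo below pre suf =
    SlidesRight U pre Lo (length pre) ×
    MovesLeftOver (drop (suc (length pre)) U) suf ×
    MovesLeftOver suf (drop (suc (length pre)) (topRow below))

  invariant-right : (U : Row) {Lo : ℕ} (below : Rows) (pre : Row) (x : L) (xs : Row) →
                    SlideInvariant U Lo below pre (x ∷ xs) → SlideInvariant U Lo below (pre ++ [ x ]) xs
  invariant-right U below pre x xs (F , A , B) with A 0 refl
  ... | u , eu , ux =
    slidesRight-∷ʳ {U} {pre} F (trans (sym (‼-drop-0 (suc (length pre)) U)) eu) ux ,
    subst (λ V → MovesLeftOver V xs) (sym (drop-past-∷ʳ pre x U))
          (movesLeftOver-drop 1 (drop (suc (length pre)) U) (x ∷ xs) A) ,
    subst (MovesLeftOver xs) (sym (drop-past-∷ʳ pre x (topRow below)))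
          (movesLeftOver-drop 1 (x ∷ xs) (drop (suc (length pre)) (topRow below)) B)

  invariant-down : (U pre suf : Row) {Lo : ℕ} (next : Row) (rest : Rows) (p : Row) (y : L) (s : Row) →
                   next ≡ p ++ y ∷ s × length p ≡ length pre →
                   ColOK next (topRow rest) → SlideInvariant U Lo (next ∷ rest) pre suf →
                   SlideInvariant (pre ++ y ∷ suf) (length pre) rest p s
  invariant-down U pre suf _ rest p y s (refl , lp) col (_ , _ , B) = F , A , C
    where
    F : SlidesRight (pre ++ y ∷ suf) p (length pre) (length p)
    F b pre≤b b<p = ⊥-elim (<-irrefl refl (<-≤-trans b<p (subst (_≤ b) (sym lp) pre≤b)))
    A : MovesLeftOver (drop (suc (length p)) (pre ++ y ∷ suf)) s
    A = subst (λ V → MovesLeftOver V s) (sym (drop-mid-at pre y suf (sym lp)))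
              (subst (MovesLeftOver suf) (drop-mid-at p y s lp) B)
    C : MovesLeftOver s (drop (suc (length p)) (topRow rest))
    C = subst (λ V → MovesLeftOver V (drop (suc (length p)) (topRow rest))) (drop-mid p y s)
              (movesLeftOver-drop (suc (length p)) (p ++ y ∷ s) (topRow rest)
                                  (ColOK⇒MovesLeftOver (p ++ y ∷ s) (topRow rest) col))

  choose-both : {A : Set} (P : A → Set) (b : Bool) {a a' : A} → P a → P a' → P (choose {m} {n} b a a')
  choose-both P true  pa _   = pa
  choose-both P false _  pa' = pa'

  -- After the slide, a box in U starting at a column ≥ Lo moves right up to some column E, and
  -- below E every slide is shorter than this one (see shallow-above).
  mutual
    slide-bound : (below : Rows) (pre suf U : Row) (Lo : ℕ) → ColsOK below →
                  SlideInvariant U Lo below pre suf → SlideBound U Lo (jdt below pre suf)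
    slide-bound below pre suf U Lo cols I = slide-step below pre suf U Lo cols I (belowEntry pre below) refl

    slide-step : (below : Rows) (pre suf U : Row) (Lo : ℕ) → ColsOK below → SlideInvariant U Lo below pre suf →
                 (sp : Split) → belowEntry pre below ≡ sp → SlideBound U Lo (jdtStep below pre suf sp)
    slide-step below pre [] U Lo _ I nothing es =
      stop-bound U pre below (split-none below es) (proj₁ I)
    slide-step below pre (x ∷ xs) U Lo cols I nothing _ =
      slide-bound below (pre ++ [ x ]) xs U Lo cols (invariant-right U below pre x xs I)
    slide-step (next ∷ rest) pre [] U Lo (col , cols) I (just (p , y , s)) es =
      descend-bound U pre y [] (jdt rest p s) (proj₁ I)
        (slide-bound rest p s (pre ++ [ y ]) (length pre) cols
          (invariant-down U pre [] next rest p y s (split-just _ next es) col I))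
    slide-step (next ∷ rest) pre (x ∷ xs) U Lo (col , cols) I (just (p , y , s)) es =
      choose-both (SlideBound U Lo) (moveLeft x y)
        (slide-bound (next ∷ rest) (pre ++ [ x ]) xs U Lo (col , cols) (invariant-right U (next ∷ rest) pre x xs I))
        (descend-bound U pre y (x ∷ xs) (jdt rest p s) (proj₁ I)
          (slide-bound rest p s (pre ++ y ∷ x ∷ xs) (length pre) cols
            (invariant-down U pre (x ∷ xs) next rest p y s (split-just _ next es) col I)))

  shallow-cons : (U : Row) (rows : Rows) {k : ℕ} → Shallow k 0 rows → Shallow (suc k) 0 (U ∷ rows)
  shallow-cons U rows G = shallow-above U rows (0 , (λ _ _ ()) , G)

  -- Comparing the two insertions

  -- z was bumped out of column P of U, so U is below z up to P, while R exceeds z at P.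
  Bumped : Row → L → Row → Set
  Bumped U z R = MovesLeftOver U R ×
    Σ ℕ λ P → (∀ b → b ≤ P → Σ L λ u → U ‼ b ≡ just u × u <ᴸ z) × (∀ {y} → R ‼ P ≡ just y → z <ᴸ y)

  bumped-below : (pre suf : Row) (z w : L) (next : Row) → IsB0 z → IsB0 w → bumps z w ≡ true → NotBumping z pre →
                 ColOK (pre ++ w ∷ suf) next → Bumped (pre ++ z ∷ suf) w next
  bumped-below pre suf z w next z∈B0 w∈B0 zw ¬b col = above , length pre , U<w , w<next
    where
    z<w : z <ᴸ w
    z<w = bumps-B0⇒< z w z∈B0 zw
    above : MovesLeftOver (pre ++ z ∷ suf) next
    above b {y} ey with ColOK-‼ (pre ++ w ∷ suf) next col ey | b ≟ length pre
    ... | x , ex , xy | yes refl with trans (sym ex) (‼-here pre w suf)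
    ...   | refl = z , ‼-here pre z suf , moveLeft-< z y (<-≤-trans z<w (ColRel⇒≤ w y xy))
    above b ey | x , ex , xy | no b≢ = x , trans (‼-replace pre z w suf b≢) ex , ColRel⇒moveLeft x _ xy
    U<w : ∀ b → b ≤ length pre → Σ L λ u → (pre ++ z ∷ suf) ‼ b ≡ just u × u <ᴸ w
    U<w b b≤ with m≤n⇒m<n∨m≡n b≤
    ... | inj₂ refl = z , ‼-here pre z suf , z<w
    ... | inj₁ b<pre with ‼-exists pre b<pre
    ...   | u , eu = u , trans (‼-++ˡ pre b<pre) eu , ≤-<-trans (unbumped-B0⇒≤ z u z∈B0 (‼-All ¬b eu)) z<w
    w<next : ∀ {y} → next ‼ length pre ≡ just y → w <ᴸ y
    w<next ey with ColOK-‼ (pre ++ w ∷ suf) next col ey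
    ... | x , ex , xy with trans (sym ex) (‼-here pre w suf)
    ...   | refl = ColRel-B0⇒< w _ w∈B0 xy

  cancel-row-shallow : (i : Fin m) (pre : Row) (w : L) (suf : Row) (rows : Rows) →
    TabFrom (suc (toℕ i)) ((pre ++ w ∷ suf) ∷ rows) → NotBumping (ub i) pre →
    (U : Row) → Bumped U (ub i) (pre ++ w ∷ suf) →
    Shallow (suc (proj₂ (jdt rows pre suf))) 0 (U ∷ proj₁ (jdt rows pre suf))
  cancel-row-shallow i pre w suf rows tab ¬b U (above , P , U<i , i<R) =
    shallow-above U (proj₁ (jdt rows pre suf)) (slide-bound rows pre suf U 0 (tab⇒ColsOK rows (tab-tail tab)) (F , A , B))
    where
    R : Row
    R = pre ++ w ∷ suf
    pre≤P : length pre ≤ P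
    pre≤P = ≮⇒≥ λ P<pre → let v , ev = ‼-exists pre P<pre in
      <⇒≱ (i<R (trans (‼-++ˡ pre P<pre) ev)) (unbumped-B0⇒≤ (ub i) v tt (‼-All ¬b ev))
    -- U is below i up to column P, and every entry of row i is at least i.
    F : SlidesRight U pre 0 (length pre)
    F b _ b<pre with U<i (suc b) (≤-trans b<pre pre≤P) | ‼-exists pre b<pre
    ... | u , eu , u<i | v , ev = u , v , eu , ev ,
      moveLeft-< u v (<-≤-trans u<i (rowBound-‼ (toℕ i) (<⇒≤ (toℕ<n i)) R (tab-bound tab)
                                                (trans (‼-++ˡ pre b<pre) ev)))
    A : MovesLeftOver (drop (suc (length pre)) U) suf
    A = subst (MovesLeftOver (drop (suc (length pre)) U)) (drop-mid pre w suf) (movesLeftOver-drop (suc (length pre)) U R above)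
    B : MovesLeftOver suf (drop (suc (length pre)) (topRow rows))
    B = subst (λ V → MovesLeftOver V (drop (suc (length pre)) (topRow rows))) (drop-mid pre w suf)
              (movesLeftOver-drop (suc (length pre)) R (topRow rows) (ColOK⇒MovesLeftOver R (topRow rows) (tab-col tab)))

  passing-bumped : {r : ℕ} (pre suf : Row) (z w : L) (rows : Rows) {T₁ : Rows} {r₁ : ℕ} →
    TabFrom r ((pre ++ w ∷ suf) ∷ rows) → bumps z w ≡ true → NotBumping z pre →
    insFrom (suc r) w rows ≡ cancel T₁ r₁ → Bumped (pre ++ z ∷ suf) w (topRow rows)
  passing-bumped {r} pre suf z w rows tab zw ¬b eq =
    bumped-below pre suf z w (topRow rows) (bumper-B0 z w zw w∈B0) w∈B0 zw ¬b (tab-col tab)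
    where
    w∈B0 : IsB0 w
    w∈B0 = cancelling⇒B0 (suc r) w rows eq

  -- U plays the part of row k: every empty box created in U ends above row r₁.
  cancelling-shallow : (k : ℕ) (z : L) (rows : Rows) {T₁ : Rows} {r₁ : ℕ} → TabFrom (suc k) rows →
    insFrom (suc k) z rows ≡ cancel T₁ r₁ → (U : Row) → Bumped U z (topRow rows) →
    Σ ℕ λ d → r₁ ≡ k + d × Shallow d 0 (U ∷ T₁)
  cancelling-shallow k z (R ∷ rows) tab eq U bU with insFrom (suc k) z (R ∷ rows) | insertionStep (suc k) z R rows
  cancelling-shallow k z (R ∷ rows) tab () U bU | _ | appends _
  cancelling-shallow k z (R ∷ rows) tab refl U bU | _ | cancels pre w suf refl ¬b c with isCancel-inv (suc k) z w c
  ... | i , refl , refl = suc (proj₂ (jdt rows pre suf)) , sym (+-suc k _) , cancel-row-shallow i pre w suf rows tab ¬b U bU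
  cancelling-shallow k z (R ∷ rows) tab eq U bU | _ | passes pre w suf refl zw ¬b _
    with consRow-inv (pre ++ z ∷ suf) (insFrom (suc (suc k)) w rows) eq
  ... | T₁' , eq' , refl with cancelling-shallow (suc k) w rows (tab-tail tab) eq' (pre ++ z ∷ suf)
                              (passing-bumped pre suf z w rows tab zw ¬b eq')
  ...   | d , refl , G = suc d , sym (+-suc k d) , shallow-cons U _ G

  leftmost-bump-≤ : (z z' v : L) (pre suf pre₂ suf₂ : Row) → IsB0 z' → NotBumping z' pre → bumps z z' ≡ true →
                    pre ++ z' ∷ suf ≡ pre₂ ++ v ∷ suf₂ → NotBumping z pre₂ → v ≤ᴸ z'
  leftmost-bump-≤ z z' v pre suf pre₂ suf₂ z'∈B0 ¬b' zz' e ¬b with <-cmp (length pre₂) (length pre)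
  ... | tri< pre₂<pre _ _ = unbumped-B0⇒≤ z' v z'∈B0 (‼-All ¬b' v∈pre)
    where
    v∈pre : pre ‼ length pre₂ ≡ just v
    v∈pre = trans (sym (‼-++ˡ pre pre₂<pre)) (trans (cong (_‼ length pre₂) e) (‼-here pre₂ v suf₂))
  ... | tri≈ _ pre₂≡pre _
    with trans (sym (‼-here pre z' suf)) (trans (cong (_‼ length pre) e) (‼-at pre₂ v suf₂ pre₂≡pre))
  ...   | refl = ≤-refl
  leftmost-bump-≤ z z' v pre suf pre₂ suf₂ z'∈B0 ¬b' zz' e ¬b | tri> _ _ pre<pre₂ with trans (sym zz') (‼-All ¬b z'∈pre₂)
    where
    z'∈pre₂ : pre₂ ‼ length pre ≡ just z'
    z'∈pre₂ = trans (sym (‼-++ˡ pre₂ pre<pre₂)) (trans (cong (_‼ length pre) (sym e)) (‼-here pre z' suf))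
  ... | ()

  -- In what follows, 2 * k ≤ rank z says that z may occur in row k + 1.
  CancelsEarlier : ℕ → L → Rows → ℕ → Set
  CancelsEarlier k z T₁ r₁ = ∃₂ λ T₂ r₂ → insFrom (suc k) z T₁ ≡ cancel T₂ r₂ × r₂ < r₁

  smaller-after-pass : (k : ℕ) (pre suf : Row) (z' z'' : L) (T₁' : Rows) {r₁ : ℕ} →
    IsB0 z' → z' <ᴸ z'' → NotBumping z' pre →
    (Σ ℕ λ d → r₁ ≡ suc k + d × Shallow d 0 ((pre ++ z' ∷ suf) ∷ T₁')) →
    (∀ v → v <ᴸ z'' → 2 * suc k ≤ rank v → CancelsEarlier (suc k) v T₁' r₁) →
    (z : L) → z <ᴸ z' → 2 * k ≤ rank z → CancelsEarlier k z ((pre ++ z' ∷ suf) ∷ T₁') r₁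
  smaller-after-pass k pre suf z' z'' T₁' z'∈B0 z'<z'' ¬b' (d , r₁≡ , G) next-row z z<z' z-bound
    with insFrom (suc k) z ((pre ++ z' ∷ suf) ∷ T₁') | insertionStep (suc k) z (pre ++ z' ∷ suf) T₁'
  ... | _ | appends ¬b =
    ⊥-elim (<⇒≱ z<z' (unbumped-B0⇒≤ z z' (below-B0 z z' z'∈B0 z<z') (‼-All ¬b (‼-here pre z' suf))))
  ... | _ | cancels pre₂ v suf₂ e _ _ =
    _ , _ , refl , subst (suc k + proj₂ (jdt T₁' pre₂ suf₂) <_) (sym r₁≡) (+-monoʳ-< (suc k) (G pre₂ v suf₂ e z≤n))
  ... | _ | passes pre₂ v suf₂ e zv ¬b c with next-row v v<z'' (rowBound-bumped k z v z∈B0 z-bound (bumps-B0⇒< z v z∈B0 zv) c)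
    where
    z∈B0 : IsB0 z
    z∈B0 = below-B0 z z' z'∈B0 z<z'
    v<z'' : v <ᴸ z''
    v<z'' = ≤-<-trans (leftmost-bump-≤ z z' v pre suf pre₂ suf₂ z'∈B0 ¬b' (<⇒bumps-B0 z z' z∈B0 z<z') e ¬b) z'<z''
  ...   | T₂ , r₂ , e₂ , r₂< = (pre₂ ++ z ∷ suf₂) ∷ T₂ , r₂ , cong (consRow (pre₂ ++ z ∷ suf₂)) e₂ , r₂<

  smaller-cancels-earlier : (k : ℕ) (z' : L) (rows : Rows) {T₁ : Rows} {r₁ : ℕ} → TabFrom (suc k) rows →
    insFrom (suc k) z' rows ≡ cancel T₁ r₁ → (z : L) → z <ᴸ z' → 2 * k ≤ rank z → CancelsEarlier k z T₁ r₁
  smaller-cancels-earlier k z' (R ∷ rows) tab eq with insFrom (suc k) z' (R ∷ rows) | insertionStep (suc k) z' R rows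
  smaller-cancels-earlier k z' (R ∷ rows) tab () | _ | appends _
  smaller-cancels-earlier k z' (R ∷ rows) tab eq | _ | cancels _ w _ _ _ c with isCancel-inv (suc k) z' w c
  ... | i , refl , refl = λ z z<z' z-bound → ⊥-elim (<⇒≱ z<z' z-bound)
  smaller-cancels-earlier k z' (R ∷ rows) tab eq | _ | passes pre z'' suf refl z'z'' ¬b' _
    with consRow-inv (pre ++ z' ∷ suf) (insFrom (suc (suc k)) z'' rows) eq
  ... | T₁' , eq' , refl =
    smaller-after-pass k pre suf z' z'' T₁' z'∈B0 (bumps-B0⇒< z' z'' z'∈B0 z'z'') ¬b'
      (cancelling-shallow (suc k) z'' rows (tab-tail tab) eq' (pre ++ z' ∷ suf)
                          (passing-bumped pre suf z' z'' rows tab z'z'' ¬b' eq'))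
      (smaller-cancels-earlier (suc k) z'' rows (tab-tail tab) eq')
    where
    z'∈B0 : IsB0 z'
    z'∈B0 = bumper-B0 z' z'' z'z'' (cancelling⇒B0 (suc (suc k)) z'' rows eq')

lemma5p3 : (m n : ℕ) → 1 ≤ m → 1 ≤ n →
    (T : List (List (Letter m n))) → IsSpoTableau T →
    (x x' : Letter m n) → IsB0 x → IsB0 x' → x <ᴸ x' →
    (T₁ : List (List (Letter m n))) (r₁ : ℕ) →
    spoInsert T x' ≡ cancel T₁ r₁ →
    ∃₂ λ (T₂ : List (List (Letter m n))) (r₂ : ℕ) →
      (spoInsert T₁ x ≡ cancel T₂ r₂) × (r₂ < r₁)
lemma5p3 m n _ _ T tab x x' _ _ x<x' T₁ r₁ eq = smaller-cancels-earlier 0 x' T tab eq x x<x' z≤n
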